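{- Let $G=(V,E)$ be a finite, connected, undirected graph (multiple edges allowed) with at least one edge, let $\eta^*$ be the optimal edge usage probabilities for the Fairest Edge Usage problem on $G$, $\eta^*_{\max}=\max_{e\in E}\eta^*(e)$, $E^*=\{e\in E:\eta^*(e)=\eta^*_{\max}\}$, and let $J\subseteq E$ be a critical set for $G$. Then for all $e\in J$, $$\eta^*(e)=\theta(J)=\theta(G)=\theta(E^*)=\eta^*_{\max}.$$
   Context: $\Gamma$ denotes the set of spanning trees of $G$, each viewed as a set of edges. For a probability mass function (pmf) $\mu$ on $\Gamma$, its edge usage probabilities are $\eta(e)=\sum_{\gamma\in\Gamma:\,e\in\gamma}\mu(\gamma)$. The Fairest Edge Usage problem is to minimize $\sum_{e\in E}\eta(e)^2$ over all pmfs $\mu$ on $\Gamma$; all minimizers induce the same edge usage probabilities, denoted $\eta^*$. For $J\subseteq E$, $\mathcal{M}(J)=\min_{\gamma\in\Gamma}|\gamma\cap J|$, and the vulnerability of $J$ is $\theta(J)=\mathcal{M}(J)/|J|$ if $J\neq\emptyset$ and $\theta(\emptyset)=0$. The vulnerability of $G$ is $\theta(G)=\max_{J\subseteq E}\theta(J)$, and $J$ is critical if $\theta(J)=\theta(G)$.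
   Formalization: The pmfs μ on Γ take rational values, and η* comes from pmfs minimizing $\sum_{e\in E}\eta(e)^2$ among rational pmfs only. -}

module Defs where

open import Data.Nat as ℕ using (ℕ; zero; suc; _∸_)
open import Data.Integer using (+_)
open import Data.Fin using (Fin)
open import Data.Fin.Subset using (Subset; Side; inside; outside; _∈_; ⊤; _∩_; ∣_∣)
open import Data.Vec using (Vec; []; _∷_; lookup; tabulate)
open import Data.List using (List; []; _∷_; [_]; map; _++_; foldr; allFin)
open import Data.Bool using (if_then_else_)
open import Data.Product using (Σ; ∃; _×_; proj₁; proj₂)
open import Data.Rational using (ℚ; 0ℚ; 1ℚ; _+_; _*_; _≤_; _/_)
open import Data.Rational.Properties using (_≟_)
open import Relation.Nullary using (¬_; does)
open import Relation.Binary.PropositionalEquality using (_≡_; _≢_)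

-- A finite undirected multigraph without loops: vertices Fin n, edges Fin m,
-- each edge has an (unordered, orientation irrelevant) pair of endpoints.
record Graph : Set where
  field
    n        : ℕ
    m        : ℕ
    ends     : Fin m → Fin n × Fin n
    loopless : ∀ e → proj₁ (ends e) ≢ proj₂ (ends e)

ℕtoℚ : ℕ → ℚ
ℕtoℚ k = + k / 1

sumℚ : List ℚ → ℚ
sumℚ = foldr _+_ 0ℚ

allSubsets : (k : ℕ) → List (Subset k)
allSubsets zero    = [ [] ]
allSubsets (suc k) = map (inside ∷_) (allSubsets k) ++ map (outside ∷_) (allSubsets k)

module _ (G : Graph) where
  open Graph G

  data Reach (T : Subset m) : Fin n → Fin n → Set where
    here : ∀ {u} → Reach T u u
    fwd  : ∀ {u} e → e ∈ T → Reach T u (proj₁ (ends e)) → Reach T u (proj₂ (ends e))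
    bwd  : ∀ {u} e → e ∈ T → Reach T u (proj₂ (ends e)) → Reach T u (proj₁ (ends e))

  Connected : Set
  Connected = ∀ u v → Reach ⊤ u v

  SpanningTree : Subset m → Set
  SpanningTree T = (∀ u v → Reach T u v) × (∣ T ∣ ≡ n ∸ 1)

  IsPMF : (Subset m → ℚ) → Set
  IsPMF μ = (∀ γ → 0ℚ ≤ μ γ)
          × (∀ γ → ¬ SpanningTree γ → μ γ ≡ 0ℚ)
          × (sumℚ (map μ (allSubsets m)) ≡ 1ℚ)

  eta : (Subset m → ℚ) → Fin m → ℚ
  eta μ e = sumℚ (map (λ γ → if lookup γ e then μ γ else 0ℚ) (allSubsets m))

  cost : (Subset m → ℚ) → ℚ
  cost μ = sumℚ (map (λ e → eta μ e * eta μ e) (allFin m))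

  Optimal : (Subset m → ℚ) → Set
  Optimal μ = IsPMF μ × (∀ μ' → IsPMF μ' → cost μ ≤ cost μ')

  IsM : Subset m → ℕ → Set
  IsM J k = (∃ λ γ → SpanningTree γ × ∣ γ ∩ J ∣ ≡ k)
          × (∀ γ → SpanningTree γ → k ℕ.≤ ∣ γ ∩ J ∣)

  -- t = θ(J) = M(J)/|J| (and θ(∅) = 0)
  IsVuln : Subset m → ℚ → Set
  IsVuln J t = Σ ℕ λ k → IsM J k × (t * ℕtoℚ ∣ J ∣ ≡ ℕtoℚ k) × (∣ J ∣ ≡ 0 → t ≡ 0ℚ)

  IsThetaG : ℚ → Set
  IsThetaG t = (∃ λ J → IsVuln J t) × (∀ J t' → IsVuln J t' → t' ≤ t)

  IsMaxEta : (Fin m → ℚ) → ℚ → Set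
  IsMaxEta η x = (∃ λ e → η e ≡ x) × (∀ e → η e ≤ x)

  Estar : (Fin m → ℚ) → ℚ → Subset m
  Estar η x = tabulate (λ e → does (η e ≟ x))

-- Let μ be optimal. Shifting a little mass from a tree γ in the support of μ to a spanning
-- tree γ − e + f changes the cost by 2ε(ε − (η(e) − η(f))), so optimality forces η(e) ≤ η(f).
-- If some spanning tree met E* in fewer edges than a support tree γ, the exchange property of
-- spanning trees would give such a pair with e ∈ γ ∩ E* and f ∉ E*, i.e. η(f) < η_max = η(e).
-- Hence every support tree attains M(E*), and double counting
-- Σ_{e ∈ X} η(e) = Σ_γ μ(γ) |γ ∩ X| gives θ(E*) = η_max ≤ θ(G). For a critical J the same
-- identity gives Σ_{e ∈ J} η(e) ≥ M(J) = θ(G) |J| ≥ η_max |J|, which forces η = θ(J) = η_max on J.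

module Submission where

open import Defs

module _ where

  open import Data.Nat as ℕ using (ℕ; zero; suc; z≤n; s≤s; _∸_)
  import Data.Nat.Properties as ℕ
  import Data.Integer as ℤ
  open import Data.Integer.Solver using () renaming (module +-*-Solver to ℤ-Solver)
  open import Data.Fin using (Fin; zero; suc)
  open import Data.Fin.Properties using (suc-injective; any?; all?) renaming (_≟_ to _≟ᶠ_)
  open import Data.Fin.Subset using (Subset; inside; outside; _∈_; _∉_; _⊆_; ⊤; _∩_; _∪_; ∁; ∣_∣; Empty)
  open import Data.Fin.Subset.Properties
    using (_∈?_; nonempty?; ∈⊤; ∣⊤∣≡n; Empty-unique; ∣⊥∣≡0; x∈p∩q⁺; x∈p∩q⁻; x∈p∪q⁺; q⊆p∪q; x∉p⇒x∈∁p)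
  open import Data.Vec using ([]; _∷_; here; there; lookup; _[_]≔_)
  open import Data.Vec.Properties
    using (∷-injectiveʳ; lookup∘update; lookup∘update′; []=⇒lookup; lookup⇒[]=; ≡-dec; lookup-zipWith; lookup∘tabulate)
  open import Data.List using (List; []; _∷_; map; _++_; allFin; tabulate)
  open import Data.List.Properties using (map-tabulate)
  open import Data.List.Relation.Unary.Any using (Any; satisfied) renaming (any? to anyˡ?)
  open import Data.List.Relation.Unary.All using (All; []; _∷_)
  open import Data.List.Relation.Unary.All.Properties using (¬Any⇒All¬)
  open import Data.Bool using (Bool; true; false; if_then_else_; _∧_) renaming (_≟_ to _≟ᵇ_)
  open import Data.Bool.Properties using (∧-identityʳ; ∧-zeroʳ)
  open import Data.Product using (∃; ∃₂; _×_; _,_; proj₁; proj₂)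
  open import Data.Sum using (_⊎_; inj₁; inj₂)
  open import Data.Rational using (ℚ; 0ℚ; 1ℚ; ½; _+_; _*_; _-_; -_; _≤_; _<_; toℚᵘ; positive; Positive; nonNegative)
  open import Data.Rational.Properties
  import Data.Rational.Unnormalised as ℚᵘ
  import Data.Rational.Unnormalised.Properties as ℚᵘ
  open import Data.Rational.Solver using (module +-*-Solver)
  open import Algebra.Bundles using (Ring)
  open import Algebra.Properties.Semiring.Sum (Ring.semiring +-*-ring) using (sum; sum-cong-≗)
  open import Relation.Nullary using (¬_; yes; no; Dec; does; contradiction)
  open import Relation.Nullary.Decidable using (map′; _×-dec_; _⊎-dec_; ¬?; dec-true)
  open import Relation.Binary.PropositionalEquality
  open import Function using (_∘_; id)

  -- Rational arithmetic

  ℕtoℚ-suc : ∀ k → ℕtoℚ (suc k) ≡ 1ℚ + ℕtoℚ k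
  ℕtoℚ-suc k = toℚᵘ-injective (begin-equality
      toℚᵘ (ℕtoℚ (suc k))                ≃⟨ toℚᵘ-fromℚᵘ (ℚᵘ.mkℚᵘ (ℤ.+ suc k) 0) ⟩
      ℚᵘ.mkℚᵘ (ℤ.+ suc k) 0                ≃⟨ ℚᵘ.*≡* (suc-cross-multiplied (ℤ.+ k)) ⟩
      ℚᵘ.1ℚᵘ ℚᵘ.+ ℚᵘ.mkℚᵘ (ℤ.+ k) 0        ≃⟨ ℚᵘ.+-congʳ ℚᵘ.1ℚᵘ (toℚᵘ-fromℚᵘ (ℚᵘ.mkℚᵘ (ℤ.+ k) 0)) ⟨
      toℚᵘ 1ℚ ℚᵘ.+ toℚᵘ (ℕtoℚ k)         ≃⟨ toℚᵘ-homo-+ 1ℚ (ℕtoℚ k) ⟨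
      toℚᵘ (1ℚ + ℕtoℚ k)                 ∎)
    where
    open ℚᵘ.≤-Reasoning
    open ℤ-Solver
    suc-cross-multiplied : ∀ x → (ℤ.+ 1 ℤ.+ x) ℤ.* (ℤ.+ 1 ℤ.* ℤ.+ 1) ≡ (ℤ.+ 1 ℤ.* ℤ.+ 1 ℤ.+ x ℤ.* ℤ.+ 1) ℤ.* ℤ.+ 1
    suc-cross-multiplied = solve 1 (λ x → (one :+ x) :* (one :* one) := (one :* one :+ x :* one) :* one) refl
      where one = con (ℤ.+ 1)

  ℕtoℚ-nonNeg : ∀ k → 0ℚ ≤ ℕtoℚ k
  ℕtoℚ-nonNeg zero    = ≤-refl
  ℕtoℚ-nonNeg (suc k) = subst (0ℚ ≤_) (sym (ℕtoℚ-suc k))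
    (+-mono-≤ (<⇒≤ (positive⁻¹ 1ℚ)) (ℕtoℚ-nonNeg k))

  ℕtoℚ-mono-≤ : ∀ {j k} → j ℕ.≤ k → ℕtoℚ j ≤ ℕtoℚ k
  ℕtoℚ-mono-≤ {zero}  {k}     z≤n       = ℕtoℚ-nonNeg k
  ℕtoℚ-mono-≤ {suc j} {suc k} (s≤s j≤k) =
    subst₂ _≤_ (sym (ℕtoℚ-suc j)) (sym (ℕtoℚ-suc k)) (+-monoʳ-≤ 1ℚ (ℕtoℚ-mono-≤ j≤k))

  y<x⇒0<x-y : ∀ {x y} → y < x → 0ℚ < x - y
  y<x⇒0<x-y {x} {y} y<x = subst (_< x - y) (+-inverseʳ y) (+-monoˡ-< (- y) y<x)

  ≤∧≢⇒< : ∀ {x y : ℚ} → x ≤ y → x ≢ y → x < y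
  ≤∧≢⇒< {x} {y} x≤y x≢y with x <? y
  ... | yes x<y = x<y
  ... | no x≮y  = contradiction (≤-antisym x≤y (≮⇒≥ x≮y)) x≢y

  x≡0⇒x*a≡x*b : ∀ {x} a b → x ≡ 0ℚ → x * a ≡ x * b
  x≡0⇒x*a≡x*b a b refl = trans (*-zeroˡ a) (sym (*-zeroˡ b))

  halve : ∀ {c} → 0ℚ < c → 0ℚ < c * ½ × c * ½ < c
  halve {c} 0<c = 0<c/2 , c/2<c
    where
    instance
      c-positive : Positive c
      c-positive = positive 0<c
    0<c/2 : 0ℚ < c * ½
    0<c/2 = positive⁻¹ (c * ½) {{pos*pos⇒pos c ½}}
    c/2<c : c * ½ < c
    c/2<c = subst₂ _<_ (+-identityʳ (c * ½)) (solve 1 (λ x → x :* con ½ :+ x :* con ½ := x) refl c) (+-monoʳ-< (c * ½) 0<c/2)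
      where
      open +-*-Solver

  positive-below-both : ∀ {p c} → 0ℚ < p → 0ℚ < c → ∃ λ ε → 0ℚ < ε × ε ≤ p × ε < c
  positive-below-both {p} {c} 0<p 0<c with ≤-total p (c * ½)
  ... | inj₁ p≤c/2 = p , 0<p , ≤-refl , ≤-<-trans p≤c/2 (proj₂ (halve 0<c))
  ... | inj₂ c/2≤p = c * ½ , proj₁ (halve 0<c) , c/2≤p , proj₂ (halve 0<c)

  0<ε<c⇒[ε+ε][ε-c]<0 : ∀ {ε c} → 0ℚ < ε → ε < c → (ε + ε) * (ε - c) < 0ℚ
  0<ε<c⇒[ε+ε][ε-c]<0 {ε} {c} 0<ε ε<c = subst ((ε + ε) * (ε - c) <_) (*-zeroʳ (ε + ε)) (*-monoʳ-<-pos (ε + ε) {{2ε-pos}} ε-c<0)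
    where
    2ε-pos : Positive (ε + ε)
    2ε-pos = positive (subst (_< ε + ε) (+-identityʳ 0ℚ) (+-mono-< 0<ε 0<ε))
    ε-c<0 : ε - c < 0ℚ
    ε-c<0 = subst (ε - c <_) (+-inverseʳ c) (+-monoˡ-< (- c) ε<c)

  y≤x⇒0≤x-y : ∀ {x y} → y ≤ x → 0ℚ ≤ x - y
  y≤x⇒0≤x-y {x} {y} y≤x = subst (_≤ x - y) (+-inverseʳ y) (+-monoˡ-≤ (- y) y≤x)

  -- Finite sums

  module _ {A : Set} where

    sumMap : (A → ℚ) → List A → ℚ
    sumMap f xs = sumℚ (map f xs)

    sumMap-cong : ∀ {f g : A → ℚ} → (∀ x → f x ≡ g x) → ∀ xs → sumMap f xs ≡ sumMap g xs
    sumMap-cong f≗g []       = refl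
    sumMap-cong f≗g (x ∷ xs) = cong₂ _+_ (f≗g x) (sumMap-cong f≗g xs)

    sumMap-zero : ∀ {f : A → ℚ} → (∀ x → f x ≡ 0ℚ) → ∀ xs → sumMap f xs ≡ 0ℚ
    sumMap-zero f≗0 xs = trans (sumMap-cong f≗0 xs) (sumMap-const-zero xs)
      where
      sumMap-const-zero : ∀ xs → sumMap (λ _ → 0ℚ) xs ≡ 0ℚ
      sumMap-const-zero []       = refl
      sumMap-const-zero (_ ∷ xs) = cong (0ℚ +_) (sumMap-const-zero xs)

    sumMap-distrib-+ : ∀ (f g : A → ℚ) xs → sumMap (λ x → f x + g x) xs ≡ sumMap f xs + sumMap g xs
    sumMap-distrib-+ f g []       = refl
    sumMap-distrib-+ f g (x ∷ xs) = begin
      (f x + g x) + sumMap (λ x → f x + g x) xs    ≡⟨ cong ((f x + g x) +_) (sumMap-distrib-+ f g xs) ⟩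
      (f x + g x) + (sumMap f xs + sumMap g xs)
        ≡⟨ solve 4 (λ a b c d → (a :+ b) :+ (c :+ d) := (a :+ c) :+ (b :+ d)) refl (f x) (g x) (sumMap f xs) (sumMap g xs) ⟩
      (f x + sumMap f xs) + (g x + sumMap g xs)    ∎
      where
      open ≡-Reasoning
      open +-*-Solver

    *-distribˡ-sumMap : ∀ c (f : A → ℚ) xs → c * sumMap f xs ≡ sumMap (λ x → c * f x) xs
    *-distribˡ-sumMap c f []       = *-zeroʳ c
    *-distribˡ-sumMap c f (x ∷ xs) = trans (*-distribˡ-+ c (f x) _) (cong (c * f x +_) (*-distribˡ-sumMap c f xs))

    sumMap-++ : ∀ (f : A → ℚ) xs ys → sumMap f (xs ++ ys) ≡ sumMap f xs + sumMap f ys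
    sumMap-++ f []       ys = sym (+-identityˡ _)
    sumMap-++ f (x ∷ xs) ys = trans (cong (f x +_) (sumMap-++ f xs ys)) (sym (+-assoc (f x) _ _))

    sumMap-mono-≤ : ∀ {f g : A → ℚ} → (∀ x → f x ≤ g x) → ∀ xs → sumMap f xs ≤ sumMap g xs
    sumMap-mono-≤ f≤g []       = ≤-refl
    sumMap-mono-≤ f≤g (x ∷ xs) = +-mono-≤ (f≤g x) (sumMap-mono-≤ f≤g xs)

    sumMap-positive : ∀ (f : A → ℚ) xs → 0ℚ < sumMap f xs → Any (λ x → 0ℚ < f x) xs
    sumMap-positive f xs 0<Σ with anyˡ? (λ x → 0ℚ <? f x) xs
    ... | yes some = some
    ... | no none  = contradiction (<-≤-trans 0<Σ (sum-nonPos xs (¬Any⇒All¬ xs none))) (<-irrefl refl)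
      where
      sum-nonPos : ∀ xs → All (λ x → ¬ 0ℚ < f x) xs → sumMap f xs ≤ 0ℚ
      sum-nonPos []       []         = ≤-refl
      sum-nonPos (x ∷ xs) (fx≯0 ∷ h) = +-mono-≤ (≮⇒≥ fx≯0) (sum-nonPos xs h)

  sumMap-map : ∀ {A B : Set} (f : B → ℚ) (g : A → B) xs → sumMap f (map g xs) ≡ sumMap (f ∘ g) xs
  sumMap-map f g []       = refl
  sumMap-map f g (x ∷ xs) = cong (f (g x) +_) (sumMap-map f g xs)

  sumMap-allSubsets-suc : ∀ m (F : Subset (suc m) → ℚ) →
    sumMap F (allSubsets (suc m)) ≡ sumMap (F ∘ (inside ∷_)) (allSubsets m) + sumMap (F ∘ (outside ∷_)) (allSubsets m)
  sumMap-allSubsets-suc m F = trans (sumMap-++ F (map (inside ∷_) Γ) (map (outside ∷_) Γ))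
                                    (cong₂ _+_ (sumMap-map F (inside ∷_) Γ) (sumMap-map F (outside ∷_) Γ))
    where Γ = allSubsets m

  sumMap-allSubsets-δ : ∀ m (F : Subset m → ℚ) γ → (∀ γ′ → γ′ ≢ γ → F γ′ ≡ 0ℚ) → sumMap F (allSubsets m) ≡ F γ
  sumMap-allSubsets-δ zero    F []          F≡0 = +-identityʳ (F [])
  sumMap-allSubsets-δ (suc m) F (true ∷ γ)  F≡0 = begin
    sumMap F (allSubsets (suc m))                                                   ≡⟨ sumMap-allSubsets-suc m F ⟩
    sumMap (F ∘ (inside ∷_)) (allSubsets m) + sumMap (F ∘ (outside ∷_)) (allSubsets m)
      ≡⟨ cong₂ _+_ (sumMap-allSubsets-δ m _ γ (λ γ′ γ′≢γ → F≡0 _ (γ′≢γ ∘ ∷-injectiveʳ)))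
                   (sumMap-zero (λ γ′ → F≡0 _ λ ())  (allSubsets m)) ⟩
    F (true ∷ γ) + 0ℚ                                                               ≡⟨ +-identityʳ _ ⟩
    F (true ∷ γ)                                                                    ∎
    where
    open ≡-Reasoning
  sumMap-allSubsets-δ (suc m) F (false ∷ γ) F≡0 = begin
    sumMap F (allSubsets (suc m))                                                   ≡⟨ sumMap-allSubsets-suc m F ⟩
    sumMap (F ∘ (inside ∷_)) (allSubsets m) + sumMap (F ∘ (outside ∷_)) (allSubsets m)
      ≡⟨ cong₂ _+_ (sumMap-zero (λ γ′ → F≡0 _ λ ())  (allSubsets m))
                   (sumMap-allSubsets-δ m _ γ (λ γ′ γ′≢γ → F≡0 _ (γ′≢γ ∘ ∷-injectiveʳ))) ⟩
    0ℚ + F (false ∷ γ)                                                              ≡⟨ +-identityˡ _ ⟩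
    F (false ∷ γ)                                                                   ∎
    where
    open ≡-Reasoning

  sumMap-allFin : ∀ {m} (f : Fin m → ℚ) → sumMap f (allFin m) ≡ sum f
  sumMap-allFin {m} f = trans (cong sumℚ (map-tabulate id f)) (sum-tabulate f)
    where
    sum-tabulate : ∀ {k} (f : Fin k → ℚ) → sumℚ (tabulate f) ≡ sum f
    sum-tabulate {zero}  f = refl
    sum-tabulate {suc k} f = cong (f zero +_) (sum-tabulate (f ∘ suc))

  sum-mono-≤ : ∀ {m} {f g : Fin m → ℚ} → (∀ i → f i ≤ g i) → sum f ≤ sum g
  sum-mono-≤ {zero}  f≤g = ≤-refl
  sum-mono-≤ {suc m} f≤g = +-mono-≤ (f≤g zero) (sum-mono-≤ (f≤g ∘ suc))

  sum-mono-< : ∀ {m} {f g : Fin m → ℚ} → (∀ i → f i ≤ g i) → ∀ i → f i < g i → sum f < sum g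
  sum-mono-< {suc m} f≤g zero    fi<gi = +-mono-<-≤ fi<gi (sum-mono-≤ (f≤g ∘ suc))
  sum-mono-< {suc m} f≤g (suc i) fi<gi = +-mono-≤-< (f≤g zero) (sum-mono-< (f≤g ∘ suc) i fi<gi)

  sum-indicator : ∀ {m} (p : Subset m) c → sum (λ i → if lookup p i then c else 0ℚ) ≡ c * ℕtoℚ ∣ p ∣
  sum-indicator []          c = sym (*-zeroʳ c)
  sum-indicator (true ∷ p)  c = begin
    c + sum (λ i → if lookup p i then c else 0ℚ)  ≡⟨ cong (c +_) (sum-indicator p c) ⟩
    c + c * ℕtoℚ ∣ p ∣                            ≡⟨ cong (_+ c * ℕtoℚ ∣ p ∣) (*-identityʳ c) ⟨
    c * 1ℚ + c * ℕtoℚ ∣ p ∣                       ≡⟨ *-distribˡ-+ c 1ℚ _ ⟨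
    c * (1ℚ + ℕtoℚ ∣ p ∣)                         ≡⟨ cong (c *_) (ℕtoℚ-suc ∣ p ∣) ⟨
    c * ℕtoℚ (suc ∣ p ∣)                          ∎
    where
    open ≡-Reasoning
  sum-indicator (false ∷ p) c = trans (+-identityˡ _) (sum-indicator p c)

  sum-sumMap-comm : ∀ {m} {A : Set} (F : Fin m → A → ℚ) xs →
    sum (λ i → sumMap (F i) xs) ≡ sumMap (λ x → sum (λ i → F i x)) xs
  sum-sumMap-comm {zero}  F xs = sym (sumMap-zero (λ _ → refl) xs)
  sum-sumMap-comm {suc m} F xs =
    trans (cong (sumMap (F zero) xs +_) (sum-sumMap-comm (F ∘ suc) xs))
          (sym (sumMap-distrib-+ (F zero) _ xs))

  sum-agree-except : ∀ {m} (h h₀ : Fin m → ℚ) i → (∀ j → j ≢ i → h j ≡ h₀ j) → sum h ≡ sum h₀ + (h i - h₀ i)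
  sum-agree-except {suc m} h h₀ zero    h≡h₀ = begin
    h zero + sum (h ∘ suc)                       ≡⟨ cong (h zero +_) (sum-cong-≗ (λ j → h≡h₀ (suc j) λ ())) ⟩
    h zero + sum (h₀ ∘ suc)                      ≡⟨ solve 3 (λ a a₀ s → a :+ s := (a₀ :+ s) :+ (a :- a₀)) refl (h zero) (h₀ zero) _ ⟩
    (h₀ zero + sum (h₀ ∘ suc)) + (h zero - h₀ zero) ∎
    where
    open ≡-Reasoning
    open +-*-Solver
  sum-agree-except {suc m} h h₀ (suc i) h≡h₀ = begin
    h zero + sum (h ∘ suc)
      ≡⟨ cong₂ _+_ (h≡h₀ zero λ ()) (sum-agree-except (h ∘ suc) (h₀ ∘ suc) i (λ j j≢i → h≡h₀ (suc j) (j≢i ∘ suc-injective))) ⟩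
    h₀ zero + (sum (h₀ ∘ suc) + (h (suc i) - h₀ (suc i))) ≡⟨ +-assoc (h₀ zero) _ _ ⟨
    (h₀ zero + sum (h₀ ∘ suc)) + (h (suc i) - h₀ (suc i)) ∎
    where
    open ≡-Reasoning

  sum-agree-except₂ : ∀ {m} (h h₀ : Fin m → ℚ) i j → i ≢ j → (∀ k → k ≢ i → k ≢ j → h k ≡ h₀ k) →
    sum h ≡ sum h₀ + ((h i - h₀ i) + (h j - h₀ j))
  sum-agree-except₂ {suc m} h h₀ zero    zero    i≢j h≡h₀ = contradiction refl i≢j
  sum-agree-except₂ {suc m} h h₀ zero    (suc j) i≢j h≡h₀ = begin
    h zero + sum (h ∘ suc)
      ≡⟨ cong (h zero +_) (sum-agree-except (h ∘ suc) (h₀ ∘ suc) j (λ k k≢j → h≡h₀ (suc k) (λ ()) (k≢j ∘ suc-injective))) ⟩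
    h zero + (sum (h₀ ∘ suc) + (h (suc j) - h₀ (suc j)))
      ≡⟨ solve 5 (λ a a₀ s b b₀ → a :+ (s :+ (b :- b₀)) := (a₀ :+ s) :+ ((a :- a₀) :+ (b :- b₀))) refl
                 (h zero) (h₀ zero) (sum (h₀ ∘ suc)) (h (suc j)) (h₀ (suc j)) ⟩
    (h₀ zero + sum (h₀ ∘ suc)) + ((h zero - h₀ zero) + (h (suc j) - h₀ (suc j))) ∎
    where
    open ≡-Reasoning
    open +-*-Solver
  sum-agree-except₂ {suc m} h h₀ (suc i) zero    i≢j h≡h₀ =
    trans (sum-agree-except₂ h h₀ zero (suc i) (i≢j ∘ sym) (λ k k≢0 k≢i → h≡h₀ k k≢i k≢0))
          (cong (sum h₀ +_) (+-comm (h zero - h₀ zero) (h (suc i) - h₀ (suc i))))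
  sum-agree-except₂ {suc m} h h₀ (suc i) (suc j) i≢j h≡h₀ = begin
    h zero + sum (h ∘ suc)
      ≡⟨ cong₂ _+_ (h≡h₀ zero (λ ()) (λ ()))
                   (sum-agree-except₂ (h ∘ suc) (h₀ ∘ suc) i j (i≢j ∘ cong suc)
                     (λ k k≢i k≢j → h≡h₀ (suc k) (k≢i ∘ suc-injective) (k≢j ∘ suc-injective))) ⟩
    h₀ zero + (sum (h₀ ∘ suc) + _) ≡⟨ +-assoc (h₀ zero) _ _ ⟨
    (h₀ zero + sum (h₀ ∘ suc)) + _ ∎
    where
    open ≡-Reasoning

  ≤-bound∧sum≥⇒≡-bound : ∀ {m} (η : Fin m → ℚ) (J : Subset m) t → (∀ {g} → g ∈ J → η g ≤ t) →
                      t * ℕtoℚ ∣ J ∣ ≤ sum (λ g → if lookup J g then η g else 0ℚ) → ∀ {e} → e ∈ J → η e ≡ t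
  ≤-bound∧sum≥⇒≡-bound η J t η≤t t|J|≤Σ {e} e∈J = ≤-antisym (η≤t e∈J) (≮⇒≥ ηe≮t)
    where
    restricted-≤ : ∀ g → (if lookup J g then η g else 0ℚ) ≤ (if lookup J g then t else 0ℚ)
    restricted-≤ g with lookup J g in eq
    ... | true  = η≤t (lookup⇒[]= g J eq)
    ... | false = ≤-refl
    ηe≮t : ¬ η e < t
    ηe≮t ηe<t = <-irrefl refl (<-≤-trans Σ<t|J| t|J|≤Σ)
      where
      at-e : ∀ {x y : ℚ} → (if lookup J e then x else y) ≡ x
      at-e rewrite []=⇒lookup e∈J = refl
      Σ<t|J| : sum (λ g → if lookup J g then η g else 0ℚ) < t * ℕtoℚ ∣ J ∣
      Σ<t|J| = subst (_ <_) (sum-indicator J t) (sum-mono-< restricted-≤ e (subst₂ _<_ (sym at-e) (sym at-e) ηe<t))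

  -- Subsets

  module _ {k : ℕ} where

    x∈p[x]≔inside : ∀ (p : Subset k) x → x ∈ p [ x ]≔ inside
    x∈p[x]≔inside p x = lookup⇒[]= x _ (lookup∘update x p inside)

    x∉p[x]≔outside : ∀ (p : Subset k) x → x ∉ p [ x ]≔ outside
    x∉p[x]≔outside p x x∈ with trans (sym ([]=⇒lookup x∈)) (lookup∘update x p outside)
    ... | ()

    y∈p∧x≢y⇒y∈p[x]≔s : ∀ {p : Subset k} {x y} s → x ≢ y → y ∈ p → y ∈ p [ x ]≔ s
    y∈p∧x≢y⇒y∈p[x]≔s {p} {y = y} s x≢y y∈p = lookup⇒[]= y _ (trans (lookup∘update′ (x≢y ∘ sym) p s) ([]=⇒lookup y∈p))

    y∈p[x]≔s∧x≢y⇒y∈p : ∀ {p : Subset k} {x y} s → x ≢ y → y ∈ p [ x ]≔ s → y ∈ p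
    y∈p[x]≔s∧x≢y⇒y∈p {p} {y = y} s x≢y y∈ = lookup⇒[]= y p (trans (sym (lookup∘update′ (x≢y ∘ sym) p s)) ([]=⇒lookup y∈))

    p[x]≔outside⊆p : ∀ (p : Subset k) x → p [ x ]≔ outside ⊆ p
    p[x]≔outside⊆p p x {y} y∈ with x ≟ᶠ y
    ... | yes refl = contradiction y∈ (x∉p[x]≔outside p x)
    ... | no x≢y   = y∈p[x]≔s∧x≢y⇒y∈p outside x≢y y∈

    p⊆p[x]≔inside : ∀ (p : Subset k) x → p ⊆ p [ x ]≔ inside
    p⊆p[x]≔inside p x {y} y∈p with x ≟ᶠ y
    ... | yes refl = x∈p[x]≔inside p x
    ... | no x≢y   = y∈p∧x≢y⇒y∈p[x]≔s inside x≢y y∈p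

    x∈p[y]≔outside⇒x≢y : ∀ {p : Subset k} {x y} → x ∈ p [ y ]≔ outside → x ≢ y
    x∈p[y]≔outside⇒x≢y {p} {x} x∈ refl = x∉p[x]≔outside p x x∈

  ∣p∣≡1+∣p[x]≔outside∣ : ∀ {k} {p : Subset k} {x} → x ∈ p → ∣ p ∣ ≡ suc ∣ p [ x ]≔ outside ∣
  ∣p∣≡1+∣p[x]≔outside∣ here                                = refl
  ∣p∣≡1+∣p[x]≔outside∣ (there {y = true} {xs = _ ∷ _} x∈p)  = cong suc (∣p∣≡1+∣p[x]≔outside∣ x∈p)
  ∣p∣≡1+∣p[x]≔outside∣ (there {y = false} {xs = _ ∷ _} x∈p) = ∣p∣≡1+∣p[x]≔outside∣ x∈p

  ∣p[x]≔inside∣≡1+∣p∣ : ∀ {k} (p : Subset k) x → x ∉ p → ∣ p [ x ]≔ inside ∣ ≡ suc ∣ p ∣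
  ∣p[x]≔inside∣≡1+∣p∣ (true  ∷ p) zero    x∉p = contradiction here x∉p
  ∣p[x]≔inside∣≡1+∣p∣ (false ∷ p) zero    x∉p = refl
  ∣p[x]≔inside∣≡1+∣p∣ (true  ∷ p) (suc x) x∉p = cong suc (∣p[x]≔inside∣≡1+∣p∣ p x (x∉p ∘ there))
  ∣p[x]≔inside∣≡1+∣p∣ (false ∷ p) (suc x) x∉p = ∣p[x]≔inside∣≡1+∣p∣ p x (x∉p ∘ there)

  ∣p∩q∣+∣p∩∁q∣≡∣p∣ : ∀ {k} (p q : Subset k) → ∣ p ∩ q ∣ ℕ.+ ∣ p ∩ ∁ q ∣ ≡ ∣ p ∣
  ∣p∩q∣+∣p∩∁q∣≡∣p∣ []          []          = refl
  ∣p∩q∣+∣p∩∁q∣≡∣p∣ (true  ∷ p) (true  ∷ q) = cong suc (∣p∩q∣+∣p∩∁q∣≡∣p∣ p q)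
  ∣p∩q∣+∣p∩∁q∣≡∣p∣ (true  ∷ p) (false ∷ q) = trans (ℕ.+-suc _ _) (cong suc (∣p∩q∣+∣p∩∁q∣≡∣p∣ p q))
  ∣p∩q∣+∣p∩∁q∣≡∣p∣ (false ∷ p) (_     ∷ q) = ∣p∩q∣+∣p∩∁q∣≡∣p∣ p q

  ∣p∪q∣≤∣p∣+∣q∣ : ∀ {k} (p q : Subset k) → ∣ p ∪ q ∣ ℕ.≤ ∣ p ∣ ℕ.+ ∣ q ∣
  ∣p∪q∣≤∣p∣+∣q∣ []          []          = z≤n
  ∣p∪q∣≤∣p∣+∣q∣ (true  ∷ p) (true  ∷ q) = s≤s (ℕ.≤-trans (∣p∪q∣≤∣p∣+∣q∣ p q) (ℕ.+-monoʳ-≤ ∣ p ∣ (ℕ.n≤1+n ∣ q ∣)))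
  ∣p∪q∣≤∣p∣+∣q∣ (true  ∷ p) (false ∷ q) = s≤s (∣p∪q∣≤∣p∣+∣q∣ p q)
  ∣p∪q∣≤∣p∣+∣q∣ (false ∷ p) (true  ∷ q) = subst (suc ∣ p ∪ q ∣ ℕ.≤_) (sym (ℕ.+-suc ∣ p ∣ ∣ q ∣)) (s≤s (∣p∪q∣≤∣p∣+∣q∣ p q))
  ∣p∪q∣≤∣p∣+∣q∣ (false ∷ p) (false ∷ q) = ∣p∪q∣≤∣p∣+∣q∣ p q

  subsingleton⇒∣p∣≤1 : ∀ {k} (p : Subset k) → (∀ {x y} → x ∈ p → y ∈ p → x ≡ y) → ∣ p ∣ ℕ.≤ 1
  subsingleton⇒∣p∣≤1 []          _         = z≤n
  subsingleton⇒∣p∣≤1 {suc k} (true  ∷ p) unique    = s≤s (ℕ.≤-reflexive (trans (cong ∣_∣ (Empty-unique rest-empty)) (∣⊥∣≡0 k)))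
    where
    rest-empty : Empty p
    rest-empty (x , x∈p) with unique here (there x∈p)
    ... | ()
  subsingleton⇒∣p∣≤1 (false ∷ p) unique    = subsingleton⇒∣p∣≤1 p (λ x∈ y∈ → suc-injective (unique (there x∈) (there y∈)))

  removal-induction : ∀ {k} (P : Subset k → Set) → (∀ {p} → Empty p → P p) →
                      (∀ {p x} → x ∈ p → P (p [ x ]≔ outside) → P p) → ∀ p → P p
  removal-induction P base step p = bounded ∣ p ∣ p ℕ.≤-refl
    where
    bounded : ∀ j p → ∣ p ∣ ℕ.≤ j → P p
    bounded j p ∣p∣≤j with nonempty? p
    bounded j       p ∣p∣≤j   | no p-empty     = base p-empty
    bounded zero    p ∣p∣≤0   | yes (x , x∈p) = contradiction (subst (ℕ._≤ 0) (∣p∣≡1+∣p[x]≔outside∣ x∈p) ∣p∣≤0) λ ()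
    bounded (suc j) p ∣p∣≤1+j | yes (x , x∈p) =
      step x∈p (bounded j _ (ℕ.≤-pred (subst (ℕ._≤ suc j) (∣p∣≡1+∣p[x]≔outside∣ x∈p) ∣p∣≤1+j)))

  -- Reachability

  module _ (G : Graph) where
    open Graph G

    end₁ end₂ : Fin m → Fin n
    end₁ e = proj₁ (ends e)
    end₂ e = proj₂ (ends e)

    Spanning : Subset m → Set
    Spanning S = ∀ u v → Reach G S u v

    Reach-edge : ∀ {S e} → e ∈ S → Reach G S (end₁ e) (end₂ e)
    Reach-edge e∈S = fwd _ e∈S here

    Reach-trans : ∀ {S u v w} → Reach G S u v → Reach G S v w → Reach G S u w
    Reach-trans p here          = p
    Reach-trans p (fwd e e∈S q) = fwd e e∈S (Reach-trans p q)
    Reach-trans p (bwd e e∈S q) = bwd e e∈S (Reach-trans p q)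

    Reach-sym : ∀ {S u v} → Reach G S u v → Reach G S v u
    Reach-sym here          = here
    Reach-sym (fwd e e∈S q) = Reach-trans (bwd e e∈S here) (Reach-sym q)
    Reach-sym (bwd e e∈S q) = Reach-trans (fwd e e∈S here) (Reach-sym q)

    Reach-reroute : ∀ {S T} → (∀ {e} → e ∈ S → Reach G T (end₁ e) (end₂ e)) → ∀ {u v} → Reach G S u v → Reach G T u v
    Reach-reroute route here          = here
    Reach-reroute route (fwd e e∈S q) = Reach-trans (Reach-reroute route q) (route e∈S)
    Reach-reroute route (bwd e e∈S q) = Reach-trans (Reach-reroute route q) (Reach-sym (route e∈S))

    Reach-mono : ∀ {S T} → S ⊆ T → ∀ {u v} → Reach G S u v → Reach G T u v
    Reach-mono S⊆T = Reach-reroute (Reach-edge ∘ S⊆T)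

    Reach-empty : ∀ {S} → Empty S → ∀ {u v} → Reach G S u v → u ≡ v
    Reach-empty S-empty here          = refl
    Reach-empty S-empty (fwd e e∈S _) = contradiction (e , e∈S) S-empty
    Reach-empty S-empty (bwd e e∈S _) = contradiction (e , e∈S) S-empty

    -- Reachability in T ∪ {e}, expressed in T alone.
    ReachWithEdge : Subset m → Fin m → Fin n → Fin n → Set
    ReachWithEdge T e x y = Reach G T x y
                          ⊎ (Reach G T x (end₁ e) × Reach G T (end₂ e) y)
                          ⊎ (Reach G T x (end₂ e) × Reach G T (end₁ e) y)

    module _ {T : Subset m} {e : Fin m} where

      ReachWithEdge-extend : ∀ {x y z} → ReachWithEdge T e x y → Reach G T y z → ReachWithEdge T e x z
      ReachWithEdge-extend (inj₁ p)              q = inj₁ (Reach-trans p q)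
      ReachWithEdge-extend (inj₂ (inj₁ (p , r))) q = inj₂ (inj₁ (p , Reach-trans r q))
      ReachWithEdge-extend (inj₂ (inj₂ (p , r))) q = inj₂ (inj₂ (p , Reach-trans r q))

      ReachWithEdge-fwd : ∀ {x} → ReachWithEdge T e x (end₁ e) → ReachWithEdge T e x (end₂ e)
      ReachWithEdge-fwd (inj₁ p)              = inj₂ (inj₁ (p , here))
      ReachWithEdge-fwd (inj₂ (inj₁ (p , _))) = inj₂ (inj₁ (p , here))
      ReachWithEdge-fwd (inj₂ (inj₂ (p , _))) = inj₁ p

      ReachWithEdge-bwd : ∀ {x} → ReachWithEdge T e x (end₂ e) → ReachWithEdge T e x (end₁ e)
      ReachWithEdge-bwd (inj₁ p)              = inj₂ (inj₂ (p , here))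
      ReachWithEdge-bwd (inj₂ (inj₁ (p , _))) = inj₁ p
      ReachWithEdge-bwd (inj₂ (inj₂ (p , _))) = inj₂ (inj₂ (p , here))

    Reach-split : ∀ {S e x y} → Reach G S x y → ReachWithEdge (S [ e ]≔ outside) e x y
    Reach-split here = inj₁ here
    Reach-split {e = e} (fwd g g∈S q) with e ≟ᶠ g
    ... | yes refl = ReachWithEdge-fwd (Reach-split q)
    ... | no e≢g   = ReachWithEdge-extend (Reach-split q) (Reach-edge (y∈p∧x≢y⇒y∈p[x]≔s outside e≢g g∈S))
    Reach-split {e = e} (bwd g g∈S q) with e ≟ᶠ g
    ... | yes refl = ReachWithEdge-bwd (Reach-split q)
    ... | no e≢g   = ReachWithEdge-extend (Reach-split q) (Reach-sym (Reach-edge (y∈p∧x≢y⇒y∈p[x]≔s outside e≢g g∈S)))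

    Reach-join : ∀ {S e} → e ∈ S → ∀ {x y} → ReachWithEdge (S [ e ]≔ outside) e x y → Reach G S x y
    Reach-join {S} {e} e∈S (inj₁ p)              = Reach-mono (p[x]≔outside⊆p S e) p
    Reach-join {S} {e} e∈S (inj₂ (inj₁ (p , q))) =
      Reach-trans (Reach-mono (p[x]≔outside⊆p S e) p) (Reach-trans (Reach-edge e∈S) (Reach-mono (p[x]≔outside⊆p S e) q))
    Reach-join {S} {e} e∈S (inj₂ (inj₂ (p , q))) =
      Reach-trans (Reach-mono (p[x]≔outside⊆p S e) p) (Reach-trans (Reach-sym (Reach-edge e∈S)) (Reach-mono (p[x]≔outside⊆p S e) q))

    reach? : ∀ S x y → Dec (Reach G S x y)
    reach? = removal-induction (λ S → ∀ x y → Dec (Reach G S x y))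
      (λ S-empty x y → map′ (λ { refl → here }) (Reach-empty S-empty) (x ≟ᶠ y))
      (λ {_} {e} e∈S reach′ x y → map′ (Reach-join e∈S) Reach-split
        (reach′ x y ⊎-dec ((reach′ x (end₁ e) ×-dec reach′ (end₂ e) y) ⊎-dec (reach′ x (end₂ e) ×-dec reach′ (end₁ e) y))))

    -- Spanning trees

    -- One representative per component of (V, S); adding an edge merges at most two components,
    -- which gives the size bound.
    record Representatives (S : Subset m) : Set where
      field
        reps       : Subset n
        rep-of     : ∀ v → ∃ λ r → r ∈ reps × Reach G S v r
        reps-apart : ∀ {r r′} → r ∈ reps → r′ ∈ reps → Reach G S r r′ → r ≡ r′
        size-bound : n ℕ.≤ ∣ reps ∣ ℕ.+ ∣ S ∣

    Representatives-empty : ∀ {S} → Empty S → Representatives S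
    Representatives-empty {S} S-empty = record
      { reps       = ⊤
      ; rep-of     = λ v → v , ∈⊤ , here
      ; reps-apart = λ _ _ → Reach-empty S-empty
      ; size-bound = subst (λ k → n ℕ.≤ k ℕ.+ ∣ S ∣) (sym (∣⊤∣≡n n)) (ℕ.m≤m+n n ∣ S ∣)
      }

    module AddEdge {S : Subset m} {e : Fin m} (e∈S : e ∈ S) (R′ : Representatives (S [ e ]≔ outside)) where
      open Representatives R′

      S′ : Subset m
      S′ = S [ e ]≔ outside

      r₁ r₂ : Fin n
      r₁ = proj₁ (rep-of (end₁ e))
      r₂ = proj₁ (rep-of (end₂ e))

      r₁∈ : r₁ ∈ reps
      r₁∈ = proj₁ (proj₂ (rep-of (end₁ e)))

      r₂∈ : r₂ ∈ reps
      r₂∈ = proj₁ (proj₂ (rep-of (end₂ e)))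

      p₁ : Reach G S′ (end₁ e) r₁
      p₁ = proj₂ (proj₂ (rep-of (end₁ e)))

      p₂ : Reach G S′ (end₂ e) r₂
      p₂ = proj₂ (proj₂ (rep-of (end₂ e)))

      lift : ∀ {x y} → Reach G S′ x y → Reach G S x y
      lift = Reach-mono (p[x]≔outside⊆p S e)

      ∣S∣≡1+∣S′∣ : ∣ S ∣ ≡ suc ∣ S′ ∣
      ∣S∣≡1+∣S′∣ = ∣p∣≡1+∣p[x]≔outside∣ e∈S

      within-component : r₁ ≡ r₂ → Representatives S
      within-component r₁≡r₂ = record
        { reps       = reps
        ; rep-of     = λ v → let (r , r∈ , p) = rep-of v in r , r∈ , lift p
        ; reps-apart = apart
        ; size-bound = ℕ.≤-trans size-bound (ℕ.+-monoʳ-≤ ∣ reps ∣ (ℕ.≤-trans (ℕ.n≤1+n _) (ℕ.≤-reflexive (sym ∣S∣≡1+∣S′∣))))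
        }
        where
        apart : ∀ {r r′} → r ∈ reps → r′ ∈ reps → Reach G S r r′ → r ≡ r′
        apart r∈ r′∈ p with Reach-split {e = e} p
        ... | inj₁ q               = reps-apart r∈ r′∈ q
        ... | inj₂ (inj₁ (q , q′)) = trans (reps-apart r∈ r₁∈ (Reach-trans q p₁))
                                       (trans r₁≡r₂ (sym (reps-apart r′∈ r₂∈ (Reach-trans (Reach-sym q′) p₂))))
        ... | inj₂ (inj₂ (q , q′)) = trans (reps-apart r∈ r₂∈ (Reach-trans q p₂))
                                       (trans (sym r₁≡r₂) (sym (reps-apart r′∈ r₁∈ (Reach-trans (Reach-sym q′) p₁))))

      joining-components : r₁ ≢ r₂ → Representatives S
      joining-components r₁≢r₂ = record
        { reps       = reps [ r₂ ]≔ outside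
        ; rep-of     = rep-of′
        ; reps-apart = apart
        ; size-bound = subst (n ℕ.≤_) (trans (cong (ℕ._+ ∣ S′ ∣) (∣p∣≡1+∣p[x]≔outside∣ r₂∈))
                                             (trans (sym (ℕ.+-suc _ ∣ S′ ∣)) (cong (∣ reps [ r₂ ]≔ outside ∣ ℕ.+_) (sym ∣S∣≡1+∣S′∣))))
                         size-bound
        }
        where
        rep-of′ : ∀ v → ∃ λ r → r ∈ reps [ r₂ ]≔ outside × Reach G S v r
        rep-of′ v with rep-of v
        ... | r , r∈ , p with r₂ ≟ᶠ r
        ...   | yes refl = r₁ , y∈p∧x≢y⇒y∈p[x]≔s outside (r₁≢r₂ ∘ sym) r₁∈ ,
                           Reach-trans (lift p) (Reach-trans (lift (Reach-sym p₂)) (Reach-trans (Reach-sym (Reach-edge e∈S)) (lift p₁)))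
        ...   | no r₂≢r  = r , y∈p∧x≢y⇒y∈p[x]≔s outside r₂≢r r∈ , lift p
        apart : ∀ {r r′} → r ∈ reps [ r₂ ]≔ outside → r′ ∈ reps [ r₂ ]≔ outside → Reach G S r r′ → r ≡ r′
        apart r∈ r′∈ p with Reach-split {e = e} p
        ... | inj₁ q               = reps-apart (p[x]≔outside⊆p reps r₂ r∈) (p[x]≔outside⊆p reps r₂ r′∈) q
        ... | inj₂ (inj₁ (_ , q′)) = contradiction (reps-apart (p[x]≔outside⊆p reps r₂ r′∈) r₂∈ (Reach-trans (Reach-sym q′) p₂))
                                                   (x∈p[y]≔outside⇒x≢y r′∈)
        ... | inj₂ (inj₂ (q , _))  = contradiction (reps-apart (p[x]≔outside⊆p reps r₂ r∈) r₂∈ (Reach-trans q p₂))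
                                                   (x∈p[y]≔outside⇒x≢y r∈)

      representatives : Representatives S
      representatives with r₁ ≟ᶠ r₂
      ... | yes r₁≡r₂ = within-component r₁≡r₂
      ... | no r₁≢r₂  = joining-components r₁≢r₂

    representatives : ∀ S → Representatives S
    representatives = removal-induction Representatives Representatives-empty AddEdge.representatives

    connected⇒n≤1+∣S∣ : ∀ S → Spanning S → n ℕ.≤ suc ∣ S ∣
    connected⇒n≤1+∣S∣ S connected = ℕ.≤-trans size-bound (ℕ.+-monoˡ-≤ ∣ S ∣ ∣reps∣≤1)
      where
      open Representatives (representatives S)
      ∣reps∣≤1 : ∣ reps ∣ ℕ.≤ 1
      ∣reps∣≤1 = subsingleton⇒∣p∣≤1 reps (λ {r} {r′} r∈ r′∈ → reps-apart r∈ r′∈ (connected r r′))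

    LeavesVia : Subset m → Subset m → Fin n → Fin n → Fin m → Set
    LeavesVia B γ u x e = (Reach G B u (end₁ e) × Reach G (γ [ e ]≔ outside) (end₂ e) x)
                        ⊎ (Reach G B u (end₂ e) × Reach G (γ [ e ]≔ outside) (end₁ e) x)

    LeavesVia-extend : ∀ {B γ u x y e} → LeavesVia B γ u x e → Reach G (γ [ e ]≔ outside) x y → LeavesVia B γ u y e
    LeavesVia-extend (inj₁ (q , r)) s = inj₁ (q , Reach-trans r s)
    LeavesVia-extend (inj₂ (q , r)) s = inj₂ (q , Reach-trans r s)

    -- Along a γ-path from u, take the last edge e ∉ B at which the path leaves the B-component of u.
    Reach-leave : ∀ {B γ u x} → Reach G γ u x → Reach G B u x ⊎ ∃ λ e → e ∈ γ × e ∉ B × LeavesVia B γ u x e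
    Reach-leave here = inj₁ here
    Reach-leave {B} {γ} {u} (fwd g g∈γ p) with reach? B u (end₂ g)
    ... | yes q = inj₁ q
    ... | no ¬q with Reach-leave p
    ...   | inj₁ q = inj₂ (g , g∈γ , (λ g∈B → ¬q (Reach-trans q (Reach-edge g∈B))) , inj₁ (q , here))
    ...   | inj₂ (e , e∈γ , e∉B , leave) with e ≟ᶠ g | leave
    ...     | yes refl | inj₁ (q , _) = inj₂ (e , e∈γ , e∉B , inj₁ (q , here))
    ...     | yes refl | inj₂ (q , _) = contradiction q ¬q
    ...     | no e≢g   | _            =
      inj₂ (e , e∈γ , e∉B , LeavesVia-extend leave (Reach-edge (y∈p∧x≢y⇒y∈p[x]≔s outside e≢g g∈γ)))
    Reach-leave {B} {γ} {u} (bwd g g∈γ p) with reach? B u (end₁ g)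
    ... | yes q = inj₁ q
    ... | no ¬q with Reach-leave p
    ...   | inj₁ q = inj₂ (g , g∈γ , (λ g∈B → ¬q (Reach-trans q (Reach-sym (Reach-edge g∈B)))) , inj₂ (q , here))
    ...   | inj₂ (e , e∈γ , e∉B , leave) with e ≟ᶠ g | leave
    ...     | yes refl | inj₁ (q , _) = contradiction q ¬q
    ...     | yes refl | inj₂ (q , _) = inj₂ (e , e∈γ , e∉B , inj₂ (q , here))
    ...     | no e≢g   | _            =
      inj₂ (e , e∈γ , e∉B , LeavesVia-extend leave (Reach-sym (Reach-edge (y∈p∧x≢y⇒y∈p[x]≔s outside e≢g g∈γ))))

    -- Otherwise (γ′ ∩ A) ∪ (γ ∖ A) would be a connected edge set with fewer than n − 1 edges.
    crossing-edge : ∀ {γ γ′} A → SpanningTree G γ → Spanning γ′ → ∣ γ′ ∩ A ∣ ℕ.< ∣ γ ∩ A ∣ →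
                    ∃ λ f → f ∉ A × ¬ Reach G (γ ∩ ∁ A) (end₁ f) (end₂ f)
    crossing-edge {γ} {γ′} A (_ , ∣γ∣≡n∸1) γ′-spans ∣γ′∩A∣<∣γ∩A∣
      with any? (λ f → (f ∈? γ′) ×-dec (¬? (f ∈? A) ×-dec ¬? (reach? (γ ∩ ∁ A) (end₁ f) (end₂ f))))
    ... | yes (f , _ , f∉A , ¬joined) = f , f∉A , ¬joined
    ... | no none = contradiction (ℕ.≤-<-trans n≤n∸1 (n∸1<n n 0<n∸1)) (ℕ.n≮n n)
      where
      B S : Subset m
      B = γ ∩ ∁ A
      S = (γ′ ∩ A) ∪ B
      route : ∀ {f} → f ∈ γ′ → Reach G S (end₁ f) (end₂ f)
      route {f} f∈γ′ with f ∈? A | reach? B (end₁ f) (end₂ f)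
      ... | yes f∈A | _        = Reach-edge (x∈p∪q⁺ (inj₁ (x∈p∩q⁺ (f∈γ′ , f∈A))))
      ... | no _    | yes p    = Reach-mono (λ {x} → q⊆p∪q (γ′ ∩ A) B {x}) p
      ... | no f∉A  | no ¬p    = contradiction (f , f∈γ′ , f∉A , ¬p) none
      ∣γ∩A∣+∣B∣≡n∸1 : ∣ γ ∩ A ∣ ℕ.+ ∣ B ∣ ≡ n ∸ 1
      ∣γ∩A∣+∣B∣≡n∸1 = trans (∣p∩q∣+∣p∩∁q∣≡∣p∣ γ A) ∣γ∣≡n∸1
      n≤n∸1 : n ℕ.≤ n ∸ 1
      n≤n∸1 = begin
        n                                    ≤⟨ connected⇒n≤1+∣S∣ S (λ u v → Reach-reroute route (γ′-spans u v)) ⟩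
        suc ∣ S ∣                             ≤⟨ s≤s (∣p∪q∣≤∣p∣+∣q∣ (γ′ ∩ A) B) ⟩
        suc ∣ γ′ ∩ A ∣ ℕ.+ ∣ B ∣              ≤⟨ ℕ.+-monoˡ-≤ ∣ B ∣ ∣γ′∩A∣<∣γ∩A∣ ⟩
        ∣ γ ∩ A ∣ ℕ.+ ∣ B ∣                   ≡⟨ ∣γ∩A∣+∣B∣≡n∸1 ⟩
        n ∸ 1                                ∎
        where
        open ℕ.≤-Reasoning
      0<n∸1 : 0 ℕ.< n ∸ 1
      0<n∸1 = ℕ.<-≤-trans (ℕ.m<n⇒0<n ∣γ′∩A∣<∣γ∩A∣) (subst (∣ γ ∩ A ∣ ℕ.≤_) ∣γ∩A∣+∣B∣≡n∸1 (ℕ.m≤m+n _ _))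
      n∸1<n : ∀ k → 0 ℕ.< k ∸ 1 → k ∸ 1 ℕ.< k
      n∸1<n (suc k) _ = ℕ.n<1+n k

    exchange-spanning : ∀ {B γ e f} → Spanning γ → B ⊆ γ [ e ]≔ outside →
                        LeavesVia B γ (end₁ f) (end₂ f) e → Spanning (γ [ e ]≔ outside [ f ]≔ inside)
    exchange-spanning {B} {γ} {e} {f} γ-spans B⊆γ⁻ leave u v = Reach-reroute route (γ-spans u v)
      where
      γ⁻⊆T : γ [ e ]≔ outside ⊆ γ [ e ]≔ outside [ f ]≔ inside
      γ⁻⊆T = p⊆p[x]≔inside (γ [ e ]≔ outside) f
      f-edge : Reach G (γ [ e ]≔ outside [ f ]≔ inside) (end₁ f) (end₂ f)
      f-edge = Reach-edge (x∈p[x]≔inside (γ [ e ]≔ outside) f)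
      e-rerouted : LeavesVia B γ (end₁ f) (end₂ f) e → Reach G (γ [ e ]≔ outside [ f ]≔ inside) (end₁ e) (end₂ e)
      e-rerouted (inj₁ (q , r)) =
        Reach-trans (Reach-sym (Reach-mono (γ⁻⊆T ∘ B⊆γ⁻) q)) (Reach-trans f-edge (Reach-sym (Reach-mono γ⁻⊆T r)))
      e-rerouted (inj₂ (q , r)) =
        Reach-trans (Reach-mono γ⁻⊆T r) (Reach-trans (Reach-sym f-edge) (Reach-mono (γ⁻⊆T ∘ B⊆γ⁻) q))
      route : ∀ {g} → g ∈ γ → Reach G (γ [ e ]≔ outside [ f ]≔ inside) (end₁ g) (end₂ g)
      route {g} g∈γ with e ≟ᶠ g
      ... | yes refl = e-rerouted leave
      ... | no e≢g   = Reach-edge (γ⁻⊆T (y∈p∧x≢y⇒y∈p[x]≔s outside e≢g g∈γ))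

    exchange : ∀ {γ γ′} A → SpanningTree G γ → Spanning γ′ → ∣ γ′ ∩ A ∣ ℕ.< ∣ γ ∩ A ∣ →
               ∃₂ λ e f → e ∈ γ × e ∈ A × f ∉ γ × f ∉ A × SpanningTree G (γ [ e ]≔ outside [ f ]≔ inside)
    exchange {γ} A γ-tree@(γ-spans , ∣γ∣≡n∸1) γ′-spans ∣γ′∩A∣<∣γ∩A∣
      with crossing-edge A γ-tree γ′-spans ∣γ′∩A∣<∣γ∩A∣
    ... | f , f∉A , ¬joined with Reach-leave {B = γ ∩ ∁ A} (γ-spans (end₁ f) (end₂ f))
    ...   | inj₁ joined = contradiction joined ¬joined
    ...   | inj₂ (e , e∈γ , e∉B , leave) =
      e , f , e∈γ , e∈A , f∉γ , f∉A , exchange-spanning γ-spans B⊆γ⁻ leave , ∣γ⁻+f∣≡n∸1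
      where
      e∈A : e ∈ A
      e∈A with e ∈? A
      ... | yes e∈A = e∈A
      ... | no e∉A  = contradiction (x∈p∩q⁺ (e∈γ , x∉p⇒x∈∁p e∉A)) e∉B
      f∉γ : f ∉ γ
      f∉γ f∈γ = ¬joined (Reach-edge (x∈p∩q⁺ (f∈γ , x∉p⇒x∈∁p f∉A)))
      B⊆γ⁻ : γ ∩ ∁ A ⊆ γ [ e ]≔ outside
      B⊆γ⁻ {x} x∈B = y∈p∧x≢y⇒y∈p[x]≔s outside (λ { refl → e∉B x∈B }) (proj₁ (x∈p∩q⁻ γ (∁ A) x∈B))
      ∣γ⁻+f∣≡n∸1 : ∣ γ [ e ]≔ outside [ f ]≔ inside ∣ ≡ n ∸ 1
      ∣γ⁻+f∣≡n∸1 = begin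
        ∣ γ [ e ]≔ outside [ f ]≔ inside ∣  ≡⟨ ∣p[x]≔inside∣≡1+∣p∣ (γ [ e ]≔ outside) f (f∉γ ∘ p[x]≔outside⊆p γ e) ⟩
        suc ∣ γ [ e ]≔ outside ∣            ≡⟨ ∣p∣≡1+∣p[x]≔outside∣ e∈γ ⟨
        ∣ γ ∣                               ≡⟨ ∣γ∣≡n∸1 ⟩
        n ∸ 1                               ∎
        where
        open ≡-Reasoning

    spanningTree? : ∀ γ → Dec (SpanningTree G γ)
    spanningTree? γ = all? (λ u → all? (λ v → reach? γ u v)) ×-dec (∣ γ ∣ ℕ.≟ n ∸ 1)

  -- Perturbing a distribution on spanning trees

  _≟ˢ_ : ∀ {k} (γ γ′ : Subset k) → Dec (γ ≡ γ′)
  _≟ˢ_ = ≡-dec _≟ᵇ_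

  pointMass : ∀ {k} → Subset k → ℚ → Subset k → ℚ
  pointMass γ c γ′ = if does (γ′ ≟ˢ γ) then c else 0ℚ

  pointMass-at : ∀ {k} (γ : Subset k) c → pointMass γ c γ ≡ c
  pointMass-at γ c with γ ≟ˢ γ
  ... | yes _   = refl
  ... | no γ≢γ  = contradiction refl γ≢γ

  pointMass-off : ∀ {k} (γ : Subset k) c {γ′} → γ′ ≢ γ → pointMass γ c γ′ ≡ 0ℚ
  pointMass-off γ c {γ′} γ′≢γ with γ′ ≟ˢ γ
  ... | yes γ′≡γ = contradiction γ′≡γ γ′≢γ
  ... | no _     = refl

  sumMap-pointMass : ∀ {m} (γ : Subset m) c → sumMap (pointMass γ c) (allSubsets m) ≡ c
  sumMap-pointMass {m} γ c = trans (sumMap-allSubsets-δ m _ γ (λ _ → pointMass-off γ c)) (pointMass-at γ c)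

  sumMap-pointMass-restricted : ∀ {m} (γ : Subset m) c g →
    sumMap (λ γ′ → if lookup γ′ g then pointMass γ c γ′ else 0ℚ) (allSubsets m) ≡ (if lookup γ g then c else 0ℚ)
  sumMap-pointMass-restricted {m} γ c g =
    trans (sumMap-allSubsets-δ m _ γ vanishes) (cong (λ x → if lookup γ g then x else 0ℚ) (pointMass-at γ c))
    where
    vanishes : ∀ γ′ → γ′ ≢ γ → (if lookup γ′ g then pointMass γ c γ′ else 0ℚ) ≡ 0ℚ
    vanishes γ′ γ′≢γ with lookup γ′ g
    ... | true  = pointMass-off γ c γ′≢γ
    ... | false = refl

  transfer : ∀ {k} → (Subset k → ℚ) → Subset k → Subset k → ℚ → Subset k → ℚ
  transfer μ γ₁ γ₂ ε γ = (μ γ + pointMass γ₂ ε γ) + pointMass γ₁ (- ε) γ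

  transfer-off : ∀ {k} (μ : Subset k → ℚ) {γ₁ γ₂} ε {γ} → γ ≢ γ₁ → γ ≢ γ₂ → transfer μ γ₁ γ₂ ε γ ≡ μ γ
  transfer-off μ {γ₁} {γ₂} ε {γ} γ≢γ₁ γ≢γ₂ =
    trans (cong₂ _+_ (cong (μ γ +_) (pointMass-off γ₂ ε γ≢γ₂)) (pointMass-off γ₁ (- ε) γ≢γ₁))
          (trans (+-identityʳ _) (+-identityʳ _))

  module _ (G : Graph) where
    open Graph G

    transfer-isPMF : ∀ {μ γ₁ γ₂ ε} → IsPMF G μ → 0ℚ < ε → ε ≤ μ γ₁ → SpanningTree G γ₂ → IsPMF G (transfer μ γ₁ γ₂ ε)
    transfer-isPMF {μ} {γ₁} {γ₂} {ε} (μ≥0 , μ-trees , Σμ≡1) 0<ε ε≤μγ₁ γ₂-tree = nonNeg , on-trees , total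
      where
      nonNeg : ∀ γ → 0ℚ ≤ transfer μ γ₁ γ₂ ε γ
      nonNeg γ = subst (0ℚ ≤_) (solve 3 (λ a b c → (a :+ c) :+ b := (a :+ b) :+ c) refl (μ γ) (pointMass γ₂ ε γ) (pointMass γ₁ (- ε) γ))
                   (subst (_≤ (μ γ + pointMass γ₁ (- ε) γ) + pointMass γ₂ ε γ) (+-identityʳ 0ℚ) (+-mono-≤ (after-removal γ) (added γ)))
        where
        open +-*-Solver
        after-removal : ∀ γ → 0ℚ ≤ μ γ + pointMass γ₁ (- ε) γ
        after-removal γ with γ ≟ˢ γ₁
        ... | yes refl = y≤x⇒0≤x-y ε≤μγ₁
        ... | no _     = subst (0ℚ ≤_) (sym (+-identityʳ (μ γ))) (μ≥0 γ)
        added : ∀ γ → 0ℚ ≤ pointMass γ₂ ε γ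
        added γ with γ ≟ˢ γ₂
        ... | yes _ = <⇒≤ 0<ε
        ... | no _  = ≤-refl
      on-trees : ∀ γ → ¬ SpanningTree G γ → transfer μ γ₁ γ₂ ε γ ≡ 0ℚ
      on-trees γ ¬tree = trans (transfer-off μ ε γ≢γ₁ (λ { refl → ¬tree γ₂-tree })) (μ-trees γ ¬tree)
        where
        γ≢γ₁ : γ ≢ γ₁
        γ≢γ₁ refl = <-irrefl (sym (μ-trees γ ¬tree)) (<-≤-trans 0<ε ε≤μγ₁)
      total : sumMap (transfer μ γ₁ γ₂ ε) (allSubsets m) ≡ 1ℚ
      total = begin
        sumMap (transfer μ γ₁ γ₂ ε) Γ
          ≡⟨ sumMap-distrib-+ _ (pointMass γ₁ (- ε)) Γ ⟩
        sumMap (λ γ → μ γ + pointMass γ₂ ε γ) Γ + sumMap (pointMass γ₁ (- ε)) Γ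
          ≡⟨ cong₂ _+_ (sumMap-distrib-+ μ (pointMass γ₂ ε) Γ) (sumMap-pointMass γ₁ (- ε)) ⟩
        (sumMap μ Γ + sumMap (pointMass γ₂ ε) Γ) + - ε
          ≡⟨ cong (λ x → (x + _) + - ε) Σμ≡1 ⟩
        (1ℚ + sumMap (pointMass γ₂ ε) Γ) + - ε
          ≡⟨ cong (λ x → (1ℚ + x) + - ε) (sumMap-pointMass γ₂ ε) ⟩
        (1ℚ + ε) + - ε
          ≡⟨ solve 1 (λ x → (con 1ℚ :+ x) :+ :- x := con 1ℚ) refl ε ⟩
        1ℚ ∎
        where
        open ≡-Reasoning
        open +-*-Solver
        Γ = allSubsets m

    eta-transfer : ∀ μ γ₁ γ₂ ε g → eta G (transfer μ γ₁ γ₂ ε) g ≡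
                   (eta G μ g + (if lookup γ₂ g then ε else 0ℚ)) + (if lookup γ₁ g then - ε else 0ℚ)
    eta-transfer μ γ₁ γ₂ ε g = begin
      sumMap (λ γ → if lookup γ g then transfer μ γ₁ γ₂ ε γ else 0ℚ) Γ
        ≡⟨ sumMap-cong (λ γ → if-distrib (lookup γ g)) Γ ⟩
      sumMap (λ γ → (restrict μ γ + restrict (pointMass γ₂ ε) γ) + restrict (pointMass γ₁ (- ε)) γ) Γ
        ≡⟨ sumMap-distrib-+ _ _ Γ ⟩
      sumMap (λ γ → restrict μ γ + restrict (pointMass γ₂ ε) γ) Γ + sumMap (restrict (pointMass γ₁ (- ε))) Γ
        ≡⟨ cong₂ _+_ (sumMap-distrib-+ _ _ Γ) (sumMap-pointMass-restricted γ₁ (- ε) g) ⟩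
      (eta G μ g + sumMap (restrict (pointMass γ₂ ε)) Γ) + (if lookup γ₁ g then - ε else 0ℚ)
        ≡⟨ cong (λ x → (eta G μ g + x) + _) (sumMap-pointMass-restricted γ₂ ε g) ⟩
      (eta G μ g + (if lookup γ₂ g then ε else 0ℚ)) + (if lookup γ₁ g then - ε else 0ℚ) ∎
      where
      open ≡-Reasoning
      Γ = allSubsets m
      restrict : (Subset m → ℚ) → Subset m → ℚ
      restrict ν γ = if lookup γ g then ν γ else 0ℚ
      if-distrib : ∀ {x y z} b → (if b then (x + y) + z else 0ℚ) ≡ ((if b then x else 0ℚ) + (if b then y else 0ℚ)) + (if b then z else 0ℚ)
      if-distrib true  = refl
      if-distrib false = refl

    module _ (μ : Subset m → ℚ) {γ : Subset m} {e f : Fin m} (e∈γ : e ∈ γ) (f∉γ : f ∉ γ) (ε : ℚ) where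
      private
        γ′ : Subset m
        γ′ = γ [ e ]≔ outside [ f ]≔ inside
        η η′ : Fin m → ℚ
        η  = eta G μ
        η′ = eta G (transfer μ γ γ′ ε)
        e≢f : e ≢ f
        e≢f refl = f∉γ e∈γ

      eta-exchange-removed : η′ e ≡ (η e + 0ℚ) + - ε
      eta-exchange-removed = trans (eta-transfer μ γ γ′ ε e)
        (cong₂ (λ b b′ → (η e + (if b then ε else 0ℚ)) + (if b′ then - ε else 0ℚ))
               (trans (lookup∘update′ e≢f (γ [ e ]≔ outside) inside) (lookup∘update e γ outside)) ([]=⇒lookup e∈γ))

      eta-exchange-added : η′ f ≡ (η f + ε) + 0ℚ
      eta-exchange-added = trans (eta-transfer μ γ γ′ ε f)
        (cong₂ (λ b b′ → (η f + (if b then ε else 0ℚ)) + (if b′ then - ε else 0ℚ))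
               (lookup∘update f (γ [ e ]≔ outside) inside) γ[f]≡false)
        where
        γ[f]≡false : lookup γ f ≡ false
        γ[f]≡false with lookup γ f in eq
        ... | true  = contradiction (lookup⇒[]= f γ eq) f∉γ
        ... | false = refl

      eta-exchange-other : ∀ {g} → g ≢ e → g ≢ f → η′ g ≡ η g
      eta-exchange-other {g} g≢e g≢f = trans (eta-transfer μ γ γ′ ε g)
        (trans (cong (λ b → (η g + (if b then ε else 0ℚ)) + (if lookup γ g then - ε else 0ℚ))
                     (trans (lookup∘update′ g≢f (γ [ e ]≔ outside) inside) (lookup∘update′ g≢e γ outside)))
               (cancel (lookup γ g)))
        where
        cancel : ∀ b → (η g + (if b then ε else 0ℚ)) + (if b then - ε else 0ℚ) ≡ η g
        cancel true  = trans (+-assoc (η g) ε (- ε)) (trans (cong (η g +_) (+-inverseʳ ε)) (+-identityʳ (η g)))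
        cancel false = trans (+-identityʳ _) (+-identityʳ (η g))

      cost-exchange : cost G (transfer μ γ γ′ ε) ≡ cost G μ + (ε + ε) * (ε - (η e - η f))
      cost-exchange = begin
        sumMap (λ g → η′ g * η′ g) (allFin m)
          ≡⟨ sumMap-allFin (λ g → η′ g * η′ g) ⟩
        sum (λ g → η′ g * η′ g)
          ≡⟨ sum-agree-except₂ (λ g → η′ g * η′ g) (λ g → η g * η g) e f e≢f
               (λ g g≢e g≢f → cong₂ _*_ (eta-exchange-other g≢e g≢f) (eta-exchange-other g≢e g≢f)) ⟩
        sum (λ g → η g * η g) + ((η′ e * η′ e - η e * η e) + (η′ f * η′ f - η f * η f))
          ≡⟨ cong₂ _+_ (sym (sumMap-allFin (λ g → η g * η g)))
                       (cong₂ (λ a b → (a * a - η e * η e) + (b * b - η f * η f)) eta-exchange-removed eta-exchange-added) ⟩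
        cost G μ + ((((η e + 0ℚ) + - ε) * ((η e + 0ℚ) + - ε) - η e * η e) + (((η f + ε) + 0ℚ) * ((η f + ε) + 0ℚ) - η f * η f))
          ≡⟨ cong (cost G μ +_) (solve 3 (λ x y ε → (((x :+ con 0ℚ) :+ :- ε) :* ((x :+ con 0ℚ) :+ :- ε) :- x :* x)
                                                    :+ (((y :+ ε) :+ con 0ℚ) :* ((y :+ ε) :+ con 0ℚ) :- y :* y)
                                                 := (ε :+ ε) :* (ε :- (x :- y))) refl (η e) (η f) ε) ⟩
        cost G μ + (ε + ε) * (ε - (η e - η f)) ∎
        where
        open ≡-Reasoning
        open +-*-Solver

    optimal⇒eta-≤-exchanged : ∀ {μ γ e f} → Optimal G μ → 0ℚ < μ γ → e ∈ γ → f ∉ γ →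
                              SpanningTree G (γ [ e ]≔ outside [ f ]≔ inside) → eta G μ e ≤ eta G μ f
    optimal⇒eta-≤-exchanged {μ} {γ} {e} {f} (pmf , minimal) 0<μγ e∈γ f∉γ tree = ≮⇒≥ no-gap
      where
      no-gap : ¬ eta G μ f < eta G μ e
      no-gap ηf<ηe with positive-below-both 0<μγ (y<x⇒0<x-y ηf<ηe)
      ... | ε , 0<ε , ε≤μγ , ε<ηe-ηf = <-irrefl refl (<-≤-trans cheaper (minimal _ (transfer-isPMF pmf 0<ε ε≤μγ tree)))
        where
        cheaper : cost G (transfer μ γ (γ [ e ]≔ outside [ f ]≔ inside) ε) < cost G μ
        cheaper = subst₂ _<_ (sym (cost-exchange μ e∈γ f∉γ ε)) (+-identityʳ (cost G μ))
                             (+-monoʳ-< (cost G μ) (0<ε<c⇒[ε+ε][ε-c]<0 0<ε ε<ηe-ηf))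

    -- Double counting

    sum-restricted-eta : ∀ μ (X : Subset m) →
      sum (λ g → if lookup X g then eta G μ g else 0ℚ) ≡ sumMap (λ γ → μ γ * ℕtoℚ ∣ γ ∩ X ∣) (allSubsets m)
    sum-restricted-eta μ X = begin
      sum (λ g → if lookup X g then eta G μ g else 0ℚ)
        ≡⟨ sum-cong-≗ restrict-inside ⟩
      sum (λ g → sumMap (λ γ → if lookup (γ ∩ X) g then μ γ else 0ℚ) Γ)
        ≡⟨ sum-sumMap-comm (λ g γ → if lookup (γ ∩ X) g then μ γ else 0ℚ) Γ ⟩
      sumMap (λ γ → sum (λ g → if lookup (γ ∩ X) g then μ γ else 0ℚ)) Γ
        ≡⟨ sumMap-cong (λ γ → sum-indicator (γ ∩ X) (μ γ)) Γ ⟩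
      sumMap (λ γ → μ γ * ℕtoℚ ∣ γ ∩ X ∣) Γ ∎
      where
      open ≡-Reasoning
      Γ = allSubsets m
      restrict-inside : ∀ g → (if lookup X g then eta G μ g else 0ℚ) ≡ sumMap (λ γ → if lookup (γ ∩ X) g then μ γ else 0ℚ) Γ
      restrict-inside g with lookup X g in eq
      ... | true  = sumMap-cong (λ γ → cong (λ b → if b then μ γ else 0ℚ)
                      (sym (trans (lookup-zipWith _∧_ g γ X) (trans (cong (lookup γ g ∧_) eq) (∧-identityʳ _))))) Γ
      ... | false = sym (sumMap-zero (λ γ → cong (λ b → if b then μ γ else 0ℚ)
                      (trans (lookup-zipWith _∧_ g γ X) (trans (cong (lookup γ g ∧_) eq) (∧-zeroʳ _)))) Γ)

    sumMap-scaled-pmf : ∀ {μ} → IsPMF G μ → ∀ c → sumMap (λ γ → μ γ * c) (allSubsets m) ≡ c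
    sumMap-scaled-pmf {μ} (_ , _ , Σμ≡1) c = begin
      sumMap (λ γ → μ γ * c) Γ   ≡⟨ sumMap-cong (λ γ → *-comm (μ γ) c) Γ ⟩
      sumMap (λ γ → c * μ γ) Γ   ≡⟨ *-distribˡ-sumMap c μ Γ ⟨
      c * sumMap μ Γ             ≡⟨ cong (c *_) Σμ≡1 ⟩
      c * 1ℚ                     ≡⟨ *-identityʳ c ⟩
      c                          ∎
      where
      open ≡-Reasoning
      Γ = allSubsets m

    M≤sum-restricted-eta : ∀ {μ J k} → IsPMF G μ → IsM G J k → ℕtoℚ k ≤ sum (λ g → if lookup J g then eta G μ g else 0ℚ)
    M≤sum-restricted-eta {μ} {J} {k} pmf@(μ≥0 , μ-trees , _) (_ , k≤trees) =
      subst₂ _≤_ (sumMap-scaled-pmf pmf (ℕtoℚ k)) (sym (sum-restricted-eta μ J)) (sumMap-mono-≤ termwise (allSubsets m))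
      where
      termwise : ∀ γ → μ γ * ℕtoℚ k ≤ μ γ * ℕtoℚ ∣ γ ∩ J ∣
      termwise γ with k ℕ.≤? ∣ γ ∩ J ∣
      ... | yes k≤ = *-monoˡ-≤-nonNeg (μ γ) {{nonNegative (μ≥0 γ)}} (ℕtoℚ-mono-≤ k≤)
      ... | no k≰  = ≤-reflexive (x≡0⇒x*a≡x*b (ℕtoℚ k) (ℕtoℚ ∣ γ ∩ J ∣) (μ-trees γ (λ tree → k≰ (k≤trees γ tree))))

    expectation-constant-on-support : ∀ {μ k} → IsPMF G μ → (X : Subset m → ℕ) → (∀ {γ} → 0ℚ < μ γ → X γ ≡ k) →
                                      sumMap (λ γ → μ γ * ℕtoℚ (X γ)) (allSubsets m) ≡ ℕtoℚ k
    expectation-constant-on-support {μ} {k} pmf@(μ≥0 , _) X constant =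
      trans (sumMap-cong termwise (allSubsets m)) (sumMap-scaled-pmf pmf (ℕtoℚ k))
      where
      termwise : ∀ γ → μ γ * ℕtoℚ (X γ) ≡ μ γ * ℕtoℚ k
      termwise γ with 0ℚ <? μ γ
      ... | yes 0<μγ = cong (λ j → μ γ * ℕtoℚ j) (constant 0<μγ)
      ... | no μγ≯0  = x≡0⇒x*a≡x*b (ℕtoℚ (X γ)) (ℕtoℚ k) (≤-antisym (≮⇒≥ μγ≯0) (μ≥0 γ))

    support⇒spanningTree : ∀ {μ γ} → IsPMF G μ → 0ℚ < μ γ → SpanningTree G γ
    support⇒spanningTree {γ = γ} (_ , μ-trees , _) 0<μγ with spanningTree? G γ
    ... | yes tree = tree
    ... | no ¬tree = contradiction (sym (μ-trees γ ¬tree)) (λ 0≡μγ → <-irrefl 0≡μγ 0<μγ)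

    Estar-lookup : ∀ (η : Fin m → ℚ) x g → lookup (Estar G η x) g ≡ does (η g ≟ x)
    Estar-lookup η x g = lookup∘tabulate (λ e → does (η e ≟ x)) g

    ∈Estar⇒≡ : ∀ η {x g} → g ∈ Estar G η x → η g ≡ x
    ∈Estar⇒≡ η {x} {g} g∈ with η g ≟ x | Estar-lookup η x g
    ... | yes ηg≡x | _  = ηg≡x
    ... | no _     | eq = contradiction (trans (sym ([]=⇒lookup g∈)) eq) λ ()

    ≡⇒∈Estar : ∀ η {x g} → η g ≡ x → g ∈ Estar G η x
    ≡⇒∈Estar η {x} {g} ηg≡x = lookup⇒[]= g _ (trans (Estar-lookup η x g) (dec-true (η g ≟ x) ηg≡x))

    module _ {μ : Subset m → ℚ} {ηmax : ℚ} (opt : Optimal G μ) (max : IsMaxEta G (eta G μ) ηmax) where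
      private
        E : Subset m
        E = Estar G (eta G μ) ηmax
        pmf : IsPMF G μ
        pmf = proj₁ opt

      support-minimizes-Estar : ∀ {γ γ′} → 0ℚ < μ γ → SpanningTree G γ′ → ∣ γ ∩ E ∣ ℕ.≤ ∣ γ′ ∩ E ∣
      support-minimizes-Estar {γ} {γ′} 0<μγ γ′-tree = ℕ.≮⇒≥ λ fewer →
        let e , f , e∈γ , e∈E , f∉γ , f∉E , tree = exchange G E (support⇒spanningTree pmf 0<μγ) (proj₁ γ′-tree) fewer
            ηf<ηe = subst (eta G μ f <_) (sym (∈Estar⇒≡ (eta G μ) e∈E)) (≤∧≢⇒< (proj₂ max f) (f∉E ∘ ≡⇒∈Estar (eta G μ)))
        in <-irrefl refl (<-≤-trans ηf<ηe (optimal⇒eta-≤-exchanged opt 0<μγ e∈γ f∉γ tree))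

      Estar-vulnerability : IsVuln G E ηmax
      Estar-vulnerability = k , M-E , ηmax∣E∣≡k , E≢∅
        where
        γ₀-support : ∃ λ γ → 0ℚ < μ γ
        γ₀-support = satisfied (sumMap-positive μ (allSubsets m) (subst (0ℚ <_) (sym (proj₂ (proj₂ pmf))) (positive⁻¹ 1ℚ)))
        γ₀ : Subset m
        γ₀ = proj₁ γ₀-support
        0<μγ₀ : 0ℚ < μ γ₀
        0<μγ₀ = proj₂ γ₀-support
        k : ℕ
        k = ∣ γ₀ ∩ E ∣
        M-E : IsM G E k
        M-E = (γ₀ , support⇒spanningTree pmf 0<μγ₀ , refl) , λ γ tree → support-minimizes-Estar 0<μγ₀ tree
        same-on-support : ∀ {γ} → 0ℚ < μ γ → ∣ γ ∩ E ∣ ≡ k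
        same-on-support 0<μγ = ℕ.≤-antisym (support-minimizes-Estar 0<μγ (support⇒spanningTree pmf 0<μγ₀))
                                          (support-minimizes-Estar 0<μγ₀ (support⇒spanningTree pmf 0<μγ))
        restricted-eta≡ηmax : ∀ g → (if lookup E g then ηmax else 0ℚ) ≡ (if lookup E g then eta G μ g else 0ℚ)
        restricted-eta≡ηmax g with lookup E g in eq
        ... | true  = sym (∈Estar⇒≡ (eta G μ) (lookup⇒[]= g E eq))
        ... | false = refl
        ηmax∣E∣≡k : ηmax * ℕtoℚ ∣ E ∣ ≡ ℕtoℚ k
        ηmax∣E∣≡k = begin
          ηmax * ℕtoℚ ∣ E ∣                                      ≡⟨ sum-indicator E ηmax ⟨
          sum (λ g → if lookup E g then ηmax else 0ℚ)           ≡⟨ sum-cong-≗ restricted-eta≡ηmax ⟩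
          sum (λ g → if lookup E g then eta G μ g else 0ℚ)      ≡⟨ sum-restricted-eta μ E ⟩
          sumMap (λ γ → μ γ * ℕtoℚ ∣ γ ∩ E ∣) (allSubsets m)
            ≡⟨ expectation-constant-on-support pmf (λ γ → ∣ γ ∩ E ∣) same-on-support ⟩
          ℕtoℚ k                                                ∎
          where
          open ≡-Reasoning
        E≢∅ : ∣ E ∣ ≡ 0 → ηmax ≡ 0ℚ
        E≢∅ ∣E∣≡0 with () ← trans (sym ∣E∣≡0) (∣p∣≡1+∣p[x]≔outside∣ (≡⇒∈Estar (eta G μ) (proj₂ (proj₁ max))))

open import Data.Nat using (_<_)
open import Data.Fin using (Fin)
open import Data.Fin.Subset using (_∈_)
open import Data.Product using (_×_; _,_; proj₁; proj₂)
open import Data.Rational using (ℚ; _≤_)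
open import Data.Rational.Properties using (≤-trans; ≤-antisym)
open import Relation.Binary.PropositionalEquality using (_≡_; sym; trans; subst)

theorem6 : (G : Graph) → Connected G → 0 < Graph.m G →
    ∀ μ → Optimal G μ →
    ∀ ηmax → IsMaxEta G (eta G μ) ηmax →
    ∀ tG → IsThetaG G tG →
    ∀ J tJ → IsVuln G J tJ → tJ ≡ tG →
    ∀ e → e ∈ J →
      (eta G μ e ≡ tJ) × (tJ ≡ tG) × IsVuln G (Estar G (eta G μ) ηmax) tG × (tG ≡ ηmax)
theorem6 G _ _ μ opt ηmax max tG (_ , tG-largest) J tJ (_ , M-J , tJ∣J∣≡k , _) tJ≡tG e e∈J =
  ηe≡tJ , tJ≡tG , subst (IsVuln G _) (sym tG≡ηmax) E-vuln , tG≡ηmax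
  where
  η : Fin (Graph.m G) → ℚ
  η = eta G μ
  E-vuln : IsVuln G (Estar G η ηmax) ηmax
  E-vuln = Estar-vulnerability G opt max
  ηmax≤tJ : ηmax ≤ tJ
  ηmax≤tJ = subst (ηmax ≤_) (sym tJ≡tG) (tG-largest _ ηmax E-vuln)
  ηe≡tJ : η e ≡ tJ
  ηe≡tJ = ≤-bound∧sum≥⇒≡-bound η J tJ (λ {g} _ → ≤-trans (proj₂ max g) ηmax≤tJ)
            (subst (_≤ _) (sym tJ∣J∣≡k) (M≤sum-restricted-eta G (proj₁ opt) M-J)) e∈J
  tG≡ηmax : tG ≡ ηmax
  tG≡ηmax = ≤-antisym (subst (_≤ ηmax) (trans ηe≡tJ tJ≡tG) (proj₂ max e)) (subst (ηmax ≤_) tJ≡tG ηmax≤tJ)
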